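{- Let $k$, $p$, $c$ be integers with $k \geq 0$, $p \geq 1$, $c \geq 3$. Let $G=(V,E)$ be a $k$-FT($pK_c$) graph with $|V|=pc+k$. Then every vertex $x\in V$: (1) belongs to a subgraph of $G$ isomorphic to $K_c$; (2) has degree at least $c+k-1$ in $G$; (3) belongs to a subgraph isomorphic to $K_c$ in $G-S$, for every $S \subset V\setminus \{x\}$ with $|S| = k$.
   Context: All graphs are finite, simple and undirected. For integers $k\ge 0$, $p\ge 1$, $c\ge 2$, a graph $G=(V,E)$ is called $k$-FT($pK_c$) if for every $S\subset V$ with $|S|\le k$, the graph $G-S$ contains as a subgraph the disjoint union of $p$ complete graphs $K_c$. -}

module Defs where

open import Data.Nat using (ℕ; _≤_)
open import Data.Bool using (Bool; true; false)
open import Data.Fin using (Fin)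
open import Data.Fin.Subset using (Subset; _∈_; _∉_; ∣_∣)
open import Data.Vec using (tabulate)
open import Data.Product using (Σ; ∃; _×_; _,_)
open import Relation.Binary.PropositionalEquality using (_≡_; _≢_)
open import Function.Definitions using (Injective)

record Graph (n : ℕ) : Set where
  field
    adj   : Fin n → Fin n → Bool
    sym   : ∀ x y → adj x y ≡ adj y x
    irrefl : ∀ x → adj x x ≡ false
open Graph public

Adj : ∀ {n} → Graph n → Fin n → Fin n → Set
Adj G x y = adj G x y ≡ true

degree : ∀ {n} → Graph n → Fin n → ℕ
degree G x = ∣ tabulate (adj G x) ∣

IsCliqueAvoiding : ∀ {n} (G : Graph n) (S : Subset n) (c : ℕ) → (Fin c → Fin n) → Set
IsCliqueAvoiding {n} G S c f =
  Injective _≡_ _≡_ f × (∀ a → f a ∉ S) × (∀ a b → a ≢ b → Adj G (f a) (f b))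

-- G - S contains p vertex-disjoint copies of K_c: an injective map
-- Fin p × Fin c → V avoiding S, each block i ↦ f (i , _) being a clique.
HasDisjointCliques : ∀ {n} (G : Graph n) (S : Subset n) (p c : ℕ) → Set
HasDisjointCliques {n} G S p c =
  Σ (Fin p × Fin c → Fin n) λ f →
    Injective _≡_ _≡_ f × (∀ q → f q ∉ S)
    × (∀ i a b → a ≢ b → Adj G (f (i , a)) (f (i , b)))

FT : ∀ {n} (k p c : ℕ) → Graph n → Set
FT {n} k p c G = ∀ (S : Subset n) → ∣ S ∣ ≤ k → HasDisjointCliques G S p c

InCliqueAvoiding : ∀ {n} (G : Graph n) (S : Subset n) (c : ℕ) → Fin n → Set
InCliqueAvoiding {n} G S c x =
  Σ (Fin c → Fin n) λ f → IsCliqueAvoiding G S c f × ∃ λ a → f a ≡ x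

-- Removing any k vertices other than x leaves exactly p·c vertices, and the p disjoint
-- copies of K_c that survive use p·c of them; so they cover every remaining vertex, in
-- particular x. This gives (3), and (1) for any such choice of k vertices. For (2),
-- choose the k removed vertices among the neighbours of x as far as possible: the
-- clique through x then still supplies c − 1 neighbours outside them.
module Submission where

open import Defs hiding (sym)
open import Data.Nat using (ℕ; zero; suc; _+_; _*_; _∸_; _≤_; _≥_; _<_; s≤s; z≤n)
open import Data.Nat.Properties
  using (≤-reflexive; ≤-trans; ≤-antisym; <-≤-trans; <-irrefl; _≤?_; ≰⇒>;
         ≤-pred; <⇒≤; <⇒≱; m≤o∸n⇒m+n≤o; m∸n≢0⇒n<m; m+n∸n≡m; +-∸-comm; m≤n+m; *-mono-≤)
open import Data.Fin using (Fin; zero; suc; punchIn; remQuot; combine)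
open import Data.Fin.Properties
  using (injective⇒≤; any?; suc-injective; punchIn-injective; punchInᵢ≢i; combine-remQuot)
  renaming (_≟_ to _≟ᶠ_)
open import Data.Fin.Subset
  using (Subset; ⊥; ∁; ⁅_⁆; _─_; _-_; _∈_; _∉_; _⊆_; ∣_∣; inside; outside)
open import Data.Fin.Subset.Properties
  using (⊥⊆; ∣⊥∣≡0; p─⊥≡p; drop-∷-⊆; x∈p∧x∉q⇒x∈p─q; x∈p∧x≢y⇒x∈p-y; x∈p⇒∣p-x∣<∣p∣;
         x∉p⇒x∈∁p; x∈∁p⇒x∉p; ∣∁p∣≡n∸∣p∣; x∈⁅x⁆; x∈⁅y⁆⇒x≡y; ∣⁅x⁆∣≡1)
open import Data.Vec.Base using ([]; _∷_; tabulate; here; there)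
open import Data.Vec.Properties using (lookup∘tabulate; lookup⇒[]=; []=⇒lookup)
open import Data.Product using (Σ; _×_; _,_; proj₂; uncurry)
open import Relation.Binary.PropositionalEquality
  using (_≡_; _≢_; refl; sym; trans; cong; subst; module ≡-Reasoning)
open import Relation.Nullary using (yes; no; contradiction)
open import Function.Definitions using (Injective)

rank : ∀ {n} (p : Subset n) {x : Fin n} → x ∈ p → Fin ∣ p ∣
rank (inside  ∷ p) here        = zero
rank (inside  ∷ p) (there x∈p) = suc (rank p x∈p)
rank (outside ∷ p) (there x∈p) = rank p x∈p

rank-injective : ∀ {n} (p : Subset n) {x y : Fin n} (x∈p : x ∈ p) (y∈p : y ∈ p) →
  rank p x∈p ≡ rank p y∈p → x ≡ y
rank-injective (inside  ∷ p) here        here        _  = refl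
rank-injective (inside  ∷ p) (there x∈p) (there y∈p) eq =
  cong suc (rank-injective p x∈p y∈p (suc-injective eq))
rank-injective (outside ∷ p) (there x∈p) (there y∈p) eq =
  cong suc (rank-injective p x∈p y∈p eq)

injective⇒≤∣p∣ : ∀ {m n} (p : Subset n) {f : Fin m → Fin n} →
  Injective _≡_ _≡_ f → (∀ i → f i ∈ p) → m ≤ ∣ p ∣
injective⇒≤∣p∣ p f-inj f∈p =
  injective⇒≤ (λ eq → f-inj (rank-injective p (f∈p _) (f∈p _) eq))

p⊆q⇒p─q≡⊥ : ∀ {n} {p q : Subset n} → p ⊆ q → p ─ q ≡ ⊥
p⊆q⇒p─q≡⊥ {p = []}          {[]}          _   = refl
p⊆q⇒p─q≡⊥ {p = _ ∷ p}       {inside ∷ q}  p⊆q = cong (outside ∷_) (p⊆q⇒p─q≡⊥ (drop-∷-⊆ p⊆q))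
p⊆q⇒p─q≡⊥ {p = outside ∷ p} {outside ∷ q} p⊆q = cong (outside ∷_) (p⊆q⇒p─q≡⊥ (drop-∷-⊆ p⊆q))
p⊆q⇒p─q≡⊥ {p = inside ∷ p}  {outside ∷ q} p⊆q with p⊆q here
... | ()

-- S takes as much of N as it can: when ∣ N ∣ ≤ k the truncated bound forces N ⊆ S.
⊆-subsetOfSize-absorbing : ∀ {n} (N A : Subset n) (k : ℕ) → N ⊆ A → k ≤ ∣ A ∣ →
  Σ (Subset n) λ S → S ⊆ A × ∣ S ∣ ≡ k × ∣ N ─ S ∣ ≤ ∣ N ∣ ∸ k
⊆-subsetOfSize-absorbing {n} N A zero _ _ =
  ⊥ , ⊥⊆ , ∣⊥∣≡0 n , ≤-reflexive (cong ∣_∣ (p─⊥≡p N))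
⊆-subsetOfSize-absorbing (inside ∷ N) (outside ∷ A) (suc k) N⊆A _ with N⊆A here
... | ()
⊆-subsetOfSize-absorbing (outside ∷ N) (outside ∷ A) (suc k) N⊆A k≤∣A∣
  with S , S⊆A , ∣S∣≡k , bound ← ⊆-subsetOfSize-absorbing N A (suc k) (drop-∷-⊆ N⊆A) k≤∣A∣
  = outside ∷ S , (λ { (there x∈S) → there (S⊆A x∈S) }) , ∣S∣≡k , bound
⊆-subsetOfSize-absorbing (inside ∷ N) (inside ∷ A) (suc k) N⊆A (s≤s k≤∣A∣)
  with S , S⊆A , ∣S∣≡k , bound ← ⊆-subsetOfSize-absorbing N A k (drop-∷-⊆ N⊆A) k≤∣A∣
  = inside ∷ S , (λ { here → here ; (there x∈S) → there (S⊆A x∈S) }) , cong suc ∣S∣≡k , bound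
⊆-subsetOfSize-absorbing {suc n} (outside ∷ N) (inside ∷ A) (suc k) N⊆A 1+k≤1+∣A∣ with suc k ≤? ∣ A ∣
... | yes 1+k≤∣A∣
  with S , S⊆A , ∣S∣≡k , bound ← ⊆-subsetOfSize-absorbing N A (suc k) (drop-∷-⊆ N⊆A) 1+k≤∣A∣
  = outside ∷ S , (λ { (there x∈S) → there (S⊆A x∈S) }) , ∣S∣≡k , bound
... | no 1+k≰∣A∣ =   -- then ∣ A ∣ ≡ k, so S is all of A
  inside ∷ A , (λ x∈A → x∈A) , cong suc (≤-antisym (≤-pred (≰⇒> 1+k≰∣A∣)) (≤-pred 1+k≤1+∣A∣)) ,
  ≤-trans (≤-reflexive (trans (cong ∣_∣ (p⊆q⇒p─q≡⊥ (drop-∷-⊆ N⊆A))) (∣⊥∣≡0 n))) z≤n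

neighbours : ∀ {n} → Graph n → Fin n → Subset n
neighbours G x = tabulate (adj G x)

Adj⇒∈neighbours : ∀ {n} (G : Graph n) {x y : Fin n} → Adj G x y → y ∈ neighbours G x
Adj⇒∈neighbours G {x} {y} xy = lookup⇒[]= y (neighbours G x) (trans (lookup∘tabulate (adj G x) y) xy)

∈neighbours⇒Adj : ∀ {n} (G : Graph n) {x y : Fin n} → y ∈ neighbours G x → Adj G x y
∈neighbours⇒Adj G {x} {y} y∈N = trans (sym (lookup∘tabulate (adj G x) y)) ([]=⇒lookup y∈N)

x∉neighbours : ∀ {n} (G : Graph n) (x : Fin n) → x ∉ neighbours G x
x∉neighbours G x x∈N with trans (sym (irrefl G x)) (∈neighbours⇒Adj G x∈N)
... | ()

neighbours⊆∁⁅x⁆ : ∀ {n} (G : Graph n) (x : Fin n) → neighbours G x ⊆ ∁ ⁅ x ⁆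
neighbours⊆∁⁅x⁆ G x y∈N = x∉p⇒x∈∁p λ y∈⁅x⁆ →
  x∉neighbours G x (subst (_∈ neighbours G x) (x∈⁅y⁆⇒x≡y x y∈⁅x⁆) y∈N)

clique⇒≤∣neighbours─S∣ : ∀ {n c} (G : Graph n) (S : Subset n) {x : Fin n} →
  InCliqueAvoiding G S (suc c) x → c ≤ ∣ neighbours G x ─ S ∣
clique⇒≤∣neighbours─S∣ G S {x} (f , (f-inj , f∉S , f-adj) , a , refl) =
  injective⇒≤∣p∣ (neighbours G x ─ S) (λ eq → punchIn-injective a _ _ (f-inj eq)) other∈N─S
  where
  other∈N─S : ∀ b → f (punchIn a b) ∈ neighbours G x ─ S
  other∈N─S b = x∈p∧x∉q⇒x∈p─q
    (Adj⇒∈neighbours G (f-adj a (punchIn a b) (λ a≡ → punchInᵢ≢i a b (sym a≡)))) (f∉S _)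

-- Otherwise the p·c clique vertices would inject into ∁ S - x, which is smaller than ∁ S.
disjointCliques-cover : ∀ {n p c} (G : Graph n) (S : Subset n) {x : Fin n} →
  HasDisjointCliques G S p c → ∣ ∁ S ∣ ≤ p * c → x ∉ S → InCliqueAvoiding G S c x
disjointCliques-cover {p = p} {c} G S {x} (g , g-inj , g∉S , g-adj) ∣∁S∣≤pc x∉S
  with any? (λ i → any? (λ a → g (i , a) ≟ᶠ x))
... | yes (i , a , gia≡x) =
  (λ b → g (i , b)) , ((λ eq → cong proj₂ (g-inj eq)) , (λ b → g∉S (i , b)) , g-adj i) , a , gia≡x
... | no x∉img = contradiction (<-≤-trans ∣∁S-x∣<pc pc≤∣∁S-x∣) (<-irrefl refl)
  where
  h : Fin (p * c) → Fin _
  h j = g (remQuot {p} c j)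
  h-inj : Injective _≡_ _≡_ h
  h-inj {j} {j′} eq = trans (sym (combine-remQuot {p} c j))
    (trans (cong (uncurry combine) (g-inj eq)) (combine-remQuot {p} c j′))
  h∈∁S-x : ∀ j → h j ∈ ∁ S - x
  h∈∁S-x j with i , a ← remQuot {p} c j =
    x∈p∧x≢y⇒x∈p-y (x∉p⇒x∈∁p (g∉S _)) (λ gia≡x → x∉img (i , a , gia≡x))
  pc≤∣∁S-x∣ : p * c ≤ ∣ ∁ S - x ∣
  pc≤∣∁S-x∣ = injective⇒≤∣p∣ (∁ S - x) h-inj h∈∁S-x
  ∣∁S-x∣<pc : ∣ ∁ S - x ∣ < p * c
  ∣∁S-x∣<pc = <-≤-trans (x∈p⇒∣p-x∣<∣p∣ (x∉p⇒x∈∁p x∉S)) ∣∁S∣≤pc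

InCliqueAvoiding-anti : ∀ {n c} (G : Graph n) {S T : Subset n} {x : Fin n} →
  T ⊆ S → InCliqueAvoiding G S c x → InCliqueAvoiding G T c x
InCliqueAvoiding-anti G T⊆S (f , (f-inj , f∉S , f-adj) , x∈f) =
  f , (f-inj , (λ a f[a]∈T → f∉S a (T⊆S f[a]∈T)) , f-adj) , x∈f

≤∣∁⁅x⁆∣ : ∀ {m} k (x : Fin (m + k)) → 1 ≤ m → k ≤ ∣ ∁ ⁅ x ⁆ ∣
≤∣∁⁅x⁆∣ {m} k x m≥1 = subst (k ≤_) (sym ∣∁⁅x⁆∣≡m∸1+k) (m≤n+m k (m ∸ 1))
  where
  open ≡-Reasoning
  ∣∁⁅x⁆∣≡m∸1+k : ∣ ∁ ⁅ x ⁆ ∣ ≡ m ∸ 1 + k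
  ∣∁⁅x⁆∣≡m∸1+k = begin
    ∣ ∁ ⁅ x ⁆ ∣        ≡⟨ ∣∁p∣≡n∸∣p∣ ⁅ x ⁆ ⟩
    m + k ∸ ∣ ⁅ x ⁆ ∣  ≡⟨ cong (m + k ∸_) (∣⁅x⁆∣≡1 x) ⟩
    m + k ∸ 1          ≡⟨ +-∸-comm k m≥1 ⟩
    m ∸ 1 + k          ∎

0<m≤o∸n⇒m+n≤o : ∀ {m n o} → 1 ≤ m → m ≤ o ∸ n → m + n ≤ o
0<m≤o∸n⇒m+n≤o {m} {n} {o} m≥1 m≤o∸n = m≤o∸n⇒m+n≤o m (<⇒≤ (m∸n≢0⇒n<m o∸n≢0)) m≤o∸n
  where
  o∸n≢0 : o ∸ n ≢ 0
  o∸n≢0 o∸n≡0 = contradiction (subst (m ≤_) o∸n≡0 m≤o∸n) (<⇒≱ m≥1)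

FT⇒inCliqueAvoiding : ∀ {k p c} (G : Graph (p * c + k)) → FT k p c G →
  (S : Subset (p * c + k)) {x : Fin (p * c + k)} → x ∉ S → ∣ S ∣ ≡ k → InCliqueAvoiding G S c x
FT⇒inCliqueAvoiding {k} {p} {c} G ft S x∉S ∣S∣≡k =
  disjointCliques-cover G S (ft S (≤-reflexive ∣S∣≡k)) (≤-reflexive ∣∁S∣≡pc) x∉S
  where
  ∣∁S∣≡pc : ∣ ∁ S ∣ ≡ p * c
  ∣∁S∣≡pc = trans (∣∁p∣≡n∸∣p∣ S) (trans (cong (p * c + k ∸_) ∣S∣≡k) (m+n∸n≡m (p * c) k))

lemma1 : (k p c : ℕ) → p ≥ 1 → c ≥ 3 → (G : Graph (p * c + k)) → FT k p c G →
    (x : Fin (p * c + k)) →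
      InCliqueAvoiding G ⊥ c x
      × degree G x ≥ c + k ∸ 1
      × ((S : Subset (p * c + k)) → x ∉ S → ∣ S ∣ ≡ k → InCliqueAvoiding G S c x)
lemma1 k p (suc c) p≥1 (s≤s c≥2) G ft x =
    InCliqueAvoiding-anti G ⊥⊆ (proj₂ (proj₂ (cliqueAvoiding ⊥ ⊥⊆)))
  , degree≥
  , λ S x∉S → FT⇒inCliqueAvoiding G ft S x∉S
  where
  k≤∣∁⁅x⁆∣ : k ≤ ∣ ∁ ⁅ x ⁆ ∣
  k≤∣∁⁅x⁆∣ = ≤∣∁⁅x⁆∣ k x (*-mono-≤ p≥1 (s≤s z≤n))
  cliqueAvoiding : (N : Subset _) → N ⊆ ∁ ⁅ x ⁆ →
    Σ (Subset _) λ S → ∣ N ─ S ∣ ≤ ∣ N ∣ ∸ k × InCliqueAvoiding G S (suc c) x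
  cliqueAvoiding N N⊆∁⁅x⁆
    with S , S⊆∁⁅x⁆ , ∣S∣≡k , ∣N─S∣≤ ← ⊆-subsetOfSize-absorbing N (∁ ⁅ x ⁆) k N⊆∁⁅x⁆ k≤∣∁⁅x⁆∣
    = S , ∣N─S∣≤ , FT⇒inCliqueAvoiding G ft S (λ x∈S → x∈∁p⇒x∉p (S⊆∁⁅x⁆ x∈S) (x∈⁅x⁆ x)) ∣S∣≡k
  degree≥ : c + k ≤ degree G x
  degree≥ with S , ∣N─S∣≤ , x∈K ← cliqueAvoiding (neighbours G x) (neighbours⊆∁⁅x⁆ G x)
    = 0<m≤o∸n⇒m+n≤o (≤-trans (s≤s z≤n) c≥2) (≤-trans (clique⇒≤∣neighbours─S∣ G S x∈K) ∣N─S∣≤)
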